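{- Let $q$ be an odd prime power and let $(a_0,b_0)\in V(\mathbb{F}_q)$. Suppose $(a_0,b_0)\mapsto(a_1,b_1)\mapsto(a_2,b_2)$ and $(a_0,b_0)\mapsto(a_1',b_1')\mapsto(a_2',b_2')$ in $A(\mathbb{F}_q)$ with $(a_1,b_1)\neq(a_1',b_1')$. Then $$\lambda(a_2,b_2)=\frac{\lambda(a_2',b_2')}{\lambda(a_2',b_2')-1}.$$
   Context: $V(\mathbb{F}_q)=\{(a,b)\in\mathbb{F}_q^2: a\neq 0,\ b\neq 0,\ a\neq \pm b\}$. For $(a,b)\in V(\mathbb{F}_q)$: if $ab$ is a square in $\mathbb{F}_q^\times$, $\mathrm{AGM}(a,b)=\{(\tfrac{a+b}{2},s),(\tfrac{a+b}{2},-s)\}$ with $s^2=ab$; otherwise $\mathrm{AGM}(a,b)=\varnothing$. The aquarium $A(\mathbb{F}_q)$ is the directed graph on $V(\mathbb{F}_q)$; $(a,b)\mapsto(a',b')$ means $(a',b')\in\mathrm{AGM}(a,b)$. $\lambda(a,b)=b^2/a^2$. -}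

module Defs where

open import Level using (0ℓ)
open import Data.Nat using (ℕ; suc)
import Data.Nat as ℕ
open import Data.Fin using (Fin)
open import Data.Product using (_×_; Σ; _,_)
import Data.Sum
open import Function.Bundles using (_⤖_)
open import Relation.Nullary using (¬_)
open import Relation.Binary.PropositionalEquality using (_≡_)
open import Algebra.Structures using (IsCommutativeRing)

Odd : ℕ → Set
Odd n = Σ ℕ (λ k → n ≡ suc (2 ℕ.* k))

-- A finite field, with propositional equality as its equality.
-- The inverse is a total function with the convention 0⁻¹ = 0;
-- only its values on nonzero elements are constrained.
record FiniteField : Set₁ where
  infixl 6 _+_
  infixl 7 _*_
  field
    Carrier : Set
    _+_ _*_ : Carrier → Carrier → Carrier
    -_      : Carrier → Carrier
    0# 1#   : Carrier
    _⁻¹     : Carrier → Carrier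
    isCommutativeRing : IsCommutativeRing _≡_ _+_ _*_ -_ 0# 1#
    0≢1     : ¬ (0# ≡ 1#)
    inverseʳ : ∀ x → ¬ (x ≡ 0#) → x * (x ⁻¹) ≡ 1#
    inv-zero : 0# ⁻¹ ≡ 0#
    size    : ℕ
    enum    : Fin size ⤖ Carrier

  _-_ : Carrier → Carrier → Carrier
  x - y = x + (- y)

  _/_ : Carrier → Carrier → Carrier
  x / y = x * (y ⁻¹)

  2# : Carrier
  2# = 1# + 1#

  _² : Carrier → Carrier
  x ² = x * x

module _ (F : FiniteField) where
  open FiniteField F

  InV : Carrier × Carrier → Set
  InV (a , b) = ¬ (a ≡ 0#) × ¬ (b ≡ 0#) × ¬ (a ≡ b) × ¬ (a ≡ - b)

  -- (a',b') ∈ AGM(a,b): ab is a square s², and (a',b') = ((a+b)/2, ±s).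
  -- Since the square roots of ab are exactly ±s, this is: a' = (a+b)/2 and b'² = ab.
  InAGM : Carrier × Carrier → Carrier × Carrier → Set
  InAGM (a , b) (a' , b') =
    Σ Carrier (λ s → (s ² ≡ a * b) × (a' ≡ (a + b) / 2#) × ((b' ≡ s) Data.Sum.⊎ (b' ≡ - s)))

  _↦_ : Carrier × Carrier → Carrier × Carrier → Set
  p ↦ p' = InV p × InV p' × InAGM p p'

  lam : Carrier × Carrier → Carrier
  lam (a , b) = (b ²) / (a ²)

-- Both AGM images of (a₀, b₀) have first coordinate (a₀ + b₀)/2, and their
-- second coordinates are the two square roots of a₀b₀; as the images are
-- distinct, they are (m, s) and (m, -s).  Their successors have first
-- coordinates A = (m + s)/2 and A' = (m - s)/2, and b₂² = ms, b₂'² = -ms.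
-- Since A² - A'² = (A + A')(A - A') = ms, we get λ' - 1 = -(ms + A'²)/A'² =
-- -A²/A'², and so λ'/(λ' - 1) = ms/A² = λ.
module Submission where

open import Defs
open import Data.Product using (_×_; _,_)
open import Data.Sum using (_⊎_; inj₁; inj₂)
open import Relation.Nullary using (¬_)
open import Relation.Binary.PropositionalEquality
open import Algebra.Bundles using (CommutativeRing)

module FieldProperties (F : FiniteField) where
  open FiniteField F
  open ≡-Reasoning

  commutativeRing : CommutativeRing _ _
  commutativeRing = record { isCommutativeRing = isCommutativeRing }

  open CommutativeRing commutativeRing
    using (+-identityʳ; *-identityˡ; *-identityʳ; zeroˡ; -‿inverseʳ; ring; +-group; commutativeSemiring)
  open import Algebra.Properties.Ring ring using (-‿distribˡ-*; -‿distribʳ-*; [y-z]x≈yx-zx)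
  open import Algebra.Properties.Group +-group
    using (ε⁻¹≈ε; ⁻¹-involutive; inverseʳ-unique; ⁻¹-anti-homo-∙; x∙y⁻¹≈ε⇒x≈y; identityʳ-unique)
  open import Algebra.Solver.Ring.NaturalCoefficients.Default commutativeSemiring
    using (solve; _:=_; _:+_; _:*_; con)

  x≢0⇒x*y≡0⇒y≡0 : ∀ {x y} → ¬ (x ≡ 0#) → x * y ≡ 0# → y ≡ 0#
  x≢0⇒x*y≡0⇒y≡0 {x} {y} x≢0 x*y≡0 = begin
    y                ≡⟨ sym (*-identityʳ y) ⟩
    y * 1#           ≡⟨ cong (y *_) (sym (inverseʳ x x≢0)) ⟩
    y * (x * x ⁻¹)   ≡⟨ solve 3 (λ y x i → y :* (x :* i) := (x :* y) :* i) refl y x (x ⁻¹) ⟩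
    (x * y) * x ⁻¹   ≡⟨ cong (_* x ⁻¹) x*y≡0 ⟩
    0# * x ⁻¹        ≡⟨ zeroˡ _ ⟩
    0#               ∎

  x≢0⇒x*x≢0 : ∀ {x} → ¬ (x ≡ 0#) → ¬ (x * x ≡ 0#)
  x≢0⇒x*x≢0 x≢0 x*x≡0 = x≢0 (x≢0⇒x*y≡0⇒y≡0 x≢0 x*x≡0)

  x≢0⇒-x≢0 : ∀ {x} → ¬ (x ≡ 0#) → ¬ (- x ≡ 0#)
  x≢0⇒-x≢0 {x} x≢0 -x≡0 = x≢0 (begin
    x       ≡⟨ sym (⁻¹-involutive x) ⟩
    - (- x) ≡⟨ cong -_ -x≡0 ⟩
    - 0#    ≡⟨ ε⁻¹≈ε ⟩
    0#      ∎)

  -x*-y≡x*y : ∀ x y → (- x) * (- y) ≡ x * y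
  -x*-y≡x*y x y = begin
    (- x) * (- y)   ≡⟨ sym (-‿distribʳ-* (- x) y) ⟩
    - ((- x) * y)   ≡⟨ cong -_ (sym (-‿distribˡ-* x y)) ⟩
    - (- (x * y))   ≡⟨ ⁻¹-involutive (x * y) ⟩
    x * y           ∎

  x≡±y⇒x*x≡y*y : ∀ {x y} → x ≡ y ⊎ x ≡ - y → x * x ≡ y * y
  x≡±y⇒x*x≡y*y     (inj₁ refl) = refl
  x≡±y⇒x*x≡y*y {y = y} (inj₂ refl) = -x*-y≡x*y y y

  x≡y+d⇒x*x≡y*y+[x+y]*d : ∀ {x y d} → x ≡ y + d → x * x ≡ y * y + (x + y) * d
  x≡y+d⇒x*x≡y*y+[x+y]*d {y = y} {d} refl =
    solve 2 (λ y d → (y :+ d) :* (y :+ d) := y :* y :+ ((y :+ d) :+ y) :* d) refl y d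

  y+[x-y]≡x : ∀ x y → y + (x - y) ≡ x
  y+[x-y]≡x x y = begin
    y + (x - y)       ≡⟨ solve 3 (λ x y n → y :+ (x :+ n) := x :+ (y :+ n)) refl x y (- y) ⟩
    x + (y - y)       ≡⟨ cong (x +_) (-‿inverseʳ y) ⟩
    x + 0#            ≡⟨ +-identityʳ x ⟩
    x                 ∎

  x*x≡y*y⇒x≢y⇒x≡-y : ∀ {x y} → x * x ≡ y * y → ¬ (x ≡ y) → x ≡ - y
  x*x≡y*y⇒x≢y⇒x≡-y {x} {y} x*x≡y*y x≢y = inverseʳ-unique y x y+x≡0
    where
    x-y≢0 : ¬ (x - y ≡ 0#)
    x-y≢0 x-y≡0 = x≢y (x∙y⁻¹≈ε⇒x≈y x y x-y≡0)

    y*y+[x+y]*[x-y]≡y*y : y * y + (x + y) * (x - y) ≡ y * y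
    y*y+[x+y]*[x-y]≡y*y =
      trans (sym (x≡y+d⇒x*x≡y*y+[x+y]*d (sym (y+[x-y]≡x x y)))) x*x≡y*y

    y+x≡0 : y + x ≡ 0#
    y+x≡0 = x≢0⇒x*y≡0⇒y≡0 x-y≢0 (begin
      (x - y) * (y + x) ≡⟨ solve 3 (λ x y d → d :* (y :+ x) := (x :+ y) :* d) refl x y (x - y) ⟩
      (x + y) * (x - y) ≡⟨ identityʳ-unique (y * y) _ y*y+[x+y]*[x-y]≡y*y ⟩
      0#                ∎)

  x≢-x⇒2≢0 : ∀ {x} → ¬ (x ≡ - x) → ¬ (2# ≡ 0#)
  x≢-x⇒2≢0 {x} x≢-x 2≡0 = x≢-x (inverseʳ-unique x x (begin
    x + x    ≡⟨ solve 1 (λ x → x :+ x := con 2 :* x) refl x ⟩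
    2# * x   ≡⟨ cong (_* x) 2≡0 ⟩
    0# * x   ≡⟨ zeroˡ x ⟩
    0#       ∎))

  ⁻¹-unique : ∀ {x y} → x * y ≡ 1# → x ⁻¹ ≡ y
  ⁻¹-unique {x} {y} x*y≡1 = begin
    x ⁻¹             ≡⟨ sym (*-identityʳ _) ⟩
    x ⁻¹ * 1#        ≡⟨ cong (x ⁻¹ *_) (sym x*y≡1) ⟩
    x ⁻¹ * (x * y)   ≡⟨ solve 3 (λ i x y → i :* (x :* y) := (x :* i) :* y) refl (x ⁻¹) x y ⟩
    (x * x ⁻¹) * y   ≡⟨ cong (_* y) (inverseʳ x x≢0) ⟩
    1# * y           ≡⟨ *-identityˡ y ⟩
    y                ∎
    where
    x≢0 : ¬ (x ≡ 0#)
    x≢0 refl = 0≢1 (trans (sym (zeroˡ y)) x*y≡1)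

  -x/-y≡x/y : ∀ x {y} → ¬ (y ≡ 0#) → (- x) / (- y) ≡ x / y
  -x/-y≡x/y x {y} y≢0 = begin
    (- x) * (- y) ⁻¹   ≡⟨ cong ((- x) *_) [-y]⁻¹≡-[y⁻¹] ⟩
    (- x) * - (y ⁻¹)   ≡⟨ -x*-y≡x*y x (y ⁻¹) ⟩
    x * y ⁻¹           ∎
    where
    [-y]⁻¹≡-[y⁻¹] : (- y) ⁻¹ ≡ - (y ⁻¹)
    [-y]⁻¹≡-[y⁻¹] = ⁻¹-unique (trans (-x*-y≡x*y y (y ⁻¹)) (inverseʳ y y≢0))

  x/z-1≡[x-z]/z : ∀ x {z} → ¬ (z ≡ 0#) → (x / z) - 1# ≡ (x - z) / z
  x/z-1≡[x-z]/z x {z} z≢0 = begin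
    (x * z ⁻¹) - 1#         ≡⟨ cong (λ w → (x * z ⁻¹) - w) (sym (inverseʳ z z≢0)) ⟩
    (x * z ⁻¹) - (z * z ⁻¹) ≡⟨ sym ([y-z]x≈yx-zx (z ⁻¹) x z) ⟩
    (x - z) * z ⁻¹          ∎

  x/z/[y/z]≡x/y : ∀ x {y z} → ¬ (y ≡ 0#) → ¬ (z ≡ 0#) → (x / z) / (y / z) ≡ x / y
  x/z/[y/z]≡x/y x {y} {z} y≢0 z≢0 = begin
    (x * z ⁻¹) * (y * z ⁻¹) ⁻¹   ≡⟨ cong ((x * z ⁻¹) *_) [y/z]⁻¹≡z/y ⟩
    (x * z ⁻¹) * (y ⁻¹ * z)      ≡⟨ solve 4 (λ x i j z → (x :* i) :* (j :* z) := (x :* j) :* (z :* i))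
                                          refl x (z ⁻¹) (y ⁻¹) z ⟩
    (x * y ⁻¹) * (z * z ⁻¹)      ≡⟨ cong ((x * y ⁻¹) *_) (inverseʳ z z≢0) ⟩
    (x * y ⁻¹) * 1#              ≡⟨ *-identityʳ _ ⟩
    x * y ⁻¹                     ∎
    where
    [y/z]⁻¹≡z/y : (y * z ⁻¹) ⁻¹ ≡ y ⁻¹ * z
    [y/z]⁻¹≡z/y = ⁻¹-unique (begin
      (y * z ⁻¹) * (y ⁻¹ * z)   ≡⟨ solve 4 (λ y i j z → (y :* i) :* (j :* z) := (y :* j) :* (z :* i))
                                       refl y (z ⁻¹) (y ⁻¹) z ⟩
      (y * y ⁻¹) * (z * z ⁻¹)   ≡⟨ cong₂ _*_ (inverseʳ y y≢0) (inverseʳ z z≢0) ⟩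
      1# * 1#                   ≡⟨ *-identityʳ 1# ⟩
      1#                        ∎)

  module _ (2≢0 : ¬ (2# ≡ 0#)) where

    [x+y]/2+[x-y]/2≡x : ∀ x y → (x + y) / 2# + (x - y) / 2# ≡ x
    [x+y]/2+[x-y]/2≡x x y = begin
      (x + y) * 2# ⁻¹ + (x - y) * 2# ⁻¹
        ≡⟨ solve 4 (λ x y n h → (x :+ y) :* h :+ (x :+ n) :* h := x :* (con 2 :* h) :+ (y :+ n) :* h)
                 refl x y (- y) (2# ⁻¹) ⟩
      x * (2# * 2# ⁻¹) + (y - y) * 2# ⁻¹
        ≡⟨ cong₂ (λ u v → x * u + v * 2# ⁻¹) (inverseʳ 2# 2≢0) (-‿inverseʳ y) ⟩
      x * 1# + 0# * 2# ⁻¹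
        ≡⟨ cong₂ _+_ (*-identityʳ x) (zeroˡ _) ⟩
      x + 0#
        ≡⟨ +-identityʳ x ⟩
      x ∎

    [x+y]/2≡[x-y]/2+y : ∀ x y → (x + y) / 2# ≡ (x - y) / 2# + y
    [x+y]/2≡[x-y]/2+y x y = sym (begin
      (x - y) * 2# ⁻¹ + y
        ≡⟨ cong ((x - y) * 2# ⁻¹ +_) (sym (*-identityʳ y)) ⟩
      (x - y) * 2# ⁻¹ + y * 1#
        ≡⟨ cong (λ w → (x - y) * 2# ⁻¹ + y * w) (sym (inverseʳ 2# 2≢0)) ⟩
      (x - y) * 2# ⁻¹ + y * (2# * 2# ⁻¹)
        ≡⟨ solve 4 (λ x y n h → (x :+ n) :* h :+ y :* (con 2 :* h) := (x :+ y) :* h :+ (y :+ n) :* h)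
                 refl x y (- y) (2# ⁻¹) ⟩
      (x + y) * 2# ⁻¹ + (y - y) * 2# ⁻¹
        ≡⟨ cong (λ v → (x + y) * 2# ⁻¹ + v * 2# ⁻¹) (-‿inverseʳ y) ⟩
      (x + y) * 2# ⁻¹ + 0# * 2# ⁻¹
        ≡⟨ cong ((x + y) * 2# ⁻¹ +_) (zeroˡ _) ⟩
      (x + y) * 2# ⁻¹ + 0#
        ≡⟨ +-identityʳ _ ⟩
      (x + y) * 2# ⁻¹ ∎)

  c/A²≡[c'/A'²]/[c'/A'²-1] : ∀ {A A' c c'} → ¬ (A ≡ 0#) → ¬ (A' ≡ 0#) →
    A * A ≡ A' * A' + c → c' ≡ - c → c / (A * A) ≡ (c' / (A' * A')) / ((c' / (A' * A')) - 1#)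
  c/A²≡[c'/A'²]/[c'/A'²-1] {A} {A'} {c} {c'} A≢0 A'≢0 A²≡A'²+c c'≡-c = begin
    c / (A * A)
      ≡⟨ sym (-x/-y≡x/y c (x≢0⇒x*x≢0 A≢0)) ⟩
    (- c) / (- (A * A))
      ≡⟨ cong (_/ (- (A * A))) (sym c'≡-c) ⟩
    c' / (- (A * A))
      ≡⟨ sym (x/z/[y/z]≡x/y c' (x≢0⇒-x≢0 (x≢0⇒x*x≢0 A≢0)) (x≢0⇒x*x≢0 A'≢0)) ⟩
    (c' / (A' * A')) / ((- (A * A)) / (A' * A'))
      ≡⟨ cong ((c' / (A' * A')) /_) (sym c'/A'²-1≡-A²/A'²) ⟩
    (c' / (A' * A')) / ((c' / (A' * A')) - 1#) ∎
    where
    c'/A'²-1≡-A²/A'² : (c' / (A' * A')) - 1# ≡ (- (A * A)) / (A' * A')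
    c'/A'²-1≡-A²/A'² = begin
      (c' / (A' * A')) - 1#            ≡⟨ x/z-1≡[x-z]/z c' (x≢0⇒x*x≢0 A'≢0) ⟩
      (c' - (A' * A')) / (A' * A')     ≡⟨ cong (λ w → (w - (A' * A')) / (A' * A')) c'≡-c ⟩
      ((- c) - (A' * A')) / (A' * A')  ≡⟨ cong (_/ (A' * A')) (sym (⁻¹-anti-homo-∙ (A' * A') c)) ⟩
      (- (A' * A' + c)) / (A' * A')    ≡⟨ cong (λ w → (- w) / (A' * A')) (sym A²≡A'²+c) ⟩
      (- (A * A)) / (A' * A')          ∎

module Aquarium (F : FiniteField) where
  open FiniteField F
  open FieldProperties F
  open import Algebra.Properties.Ring (CommutativeRing.ring commutativeRing) using (-‿distribʳ-*)
  open ≡-Reasoning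

  ↦-fst : ∀ {a b a' b'} → _↦_ F (a , b) (a' , b') → a' ≡ (a + b) / 2#
  ↦-fst (_ , _ , _ , _ , a'≡[a+b]/2 , _) = a'≡[a+b]/2

  ↦-snd² : ∀ {a b a' b'} → _↦_ F (a , b) (a' , b') → b' * b' ≡ a * b
  ↦-snd² (_ , _ , s , s*s≡a*b , _ , b'≡±s) = trans (x≡±y⇒x*x≡y*y b'≡±s) s*s≡a*b

  ↦-siblings : ∀ {p a₁ b₁ p₁'} → _↦_ F p (a₁ , b₁) → _↦_ F p p₁' → ¬ ((a₁ , b₁) ≡ p₁') →
               p₁' ≡ (a₁ , - b₁)
  ↦-siblings {a₁ = a₁} {b₁} {a₁' , b₁'} p↦p₁ p↦p₁' p₁≢p₁' = cong₂ _,_ a₁'≡a₁ b₁'≡-b₁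
    where
    a₁'≡a₁ : a₁' ≡ a₁
    a₁'≡a₁ = trans (↦-fst p↦p₁') (sym (↦-fst p↦p₁))

    b₁'≡-b₁ : b₁' ≡ - b₁
    b₁'≡-b₁ = x*x≡y*y⇒x≢y⇒x≡-y (trans (↦-snd² p↦p₁') (sym (↦-snd² p↦p₁)))
                (λ b₁'≡b₁ → p₁≢p₁' (cong₂ _,_ (sym a₁'≡a₁) (sym b₁'≡b₁)))

  lam-successors-of-siblings : ∀ {m s p p'} → ¬ (2# ≡ 0#) → _↦_ F (m , s) p → _↦_ F (m , - s) p' →
                               lam F p ≡ lam F p' / (lam F p' - 1#)
  lam-successors-of-siblings {m} {s} {A , B} {A' , B'} 2≢0
    ms↦p@(_ , (A≢0 , _) , _) m-s↦p'@(_ , (A'≢0 , _) , _) =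
    c/A²≡[c'/A'²]/[c'/A'²-1] A≢0 A'≢0 A²≡A'²+B² B'²≡-B²
    where
    A≡A'+s : A ≡ A' + s
    A≡A'+s = trans (↦-fst ms↦p) (trans ([x+y]/2≡[x-y]/2+y 2≢0 m s) (cong (_+ s) (sym (↦-fst m-s↦p'))))

    A+A'≡m : A + A' ≡ m
    A+A'≡m = trans (cong₂ _+_ (↦-fst ms↦p) (↦-fst m-s↦p')) ([x+y]/2+[x-y]/2≡x 2≢0 m s)

    A²≡A'²+B² : A * A ≡ A' * A' + B * B
    A²≡A'²+B² = begin
      A * A                  ≡⟨ x≡y+d⇒x*x≡y*y+[x+y]*d A≡A'+s ⟩
      A' * A' + (A + A') * s ≡⟨ cong (λ w → A' * A' + w * s) A+A'≡m ⟩
      A' * A' + m * s        ≡⟨ cong (A' * A' +_) (sym (↦-snd² ms↦p)) ⟩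
      A' * A' + B * B        ∎

    B'²≡-B² : B' * B' ≡ - (B * B)
    B'²≡-B² = begin
      B' * B'     ≡⟨ ↦-snd² m-s↦p' ⟩
      m * - s     ≡⟨ sym (-‿distribʳ-* m s) ⟩
      - (m * s)   ≡⟨ cong -_ (sym (↦-snd² ms↦p)) ⟩
      - (B * B)   ∎

lemma3p1 : (F : FiniteField) → Odd (FiniteField.size F) →
    (p₀ p₁ p₂ p₁' p₂' : FiniteField.Carrier F × FiniteField.Carrier F) →
    InV F p₀ →
    _↦_ F p₀ p₁ → _↦_ F p₁ p₂ → _↦_ F p₀ p₁' → _↦_ F p₁' p₂' →
    ¬ (p₁ ≡ p₁') →
    lam F p₂ ≡ FiniteField._/_ F (lam F p₂') (FiniteField._-_ F (lam F p₂') (FiniteField.1# F))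
lemma3p1 F _ p₀ (a₁ , b₁) p₂ p₁' p₂' _ p₀↦p₁ p₁↦p₂ p₀↦p₁' p₁'↦p₂' p₁≢p₁' =
  lam-successors-of-siblings 2≢0 p₁↦p₂ (subst (λ p → _↦_ F p p₂') p₁'≡[a₁,-b₁] p₁'↦p₂')
  where
  open FiniteField F
  open FieldProperties F
  open Aquarium F

  p₁'≡[a₁,-b₁] : p₁' ≡ (a₁ , - b₁)
  p₁'≡[a₁,-b₁] = ↦-siblings p₀↦p₁ p₀↦p₁' p₁≢p₁'

  2≢0 : ¬ (2# ≡ 0#)
  2≢0 = x≢-x⇒2≢0 (λ b₁≡-b₁ → p₁≢p₁' (sym (trans p₁'≡[a₁,-b₁] (cong (a₁ ,_) (sym b₁≡-b₁)))))
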